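{- Let $n\geq 3$ and let $D_n=\langle r,s\mid r^n=s^2=rsrs=e\rangle$ be the dihedral group of order $2n$. In the three-player game $\texttt{REL}_3(D_n,\{r,s\})$, Player 1 has a winning strategy if $n$ is odd, and Player 3 has a winning strategy if $n$ is even.
   Context: Game $\texttt{REL}_3(G,S)$: $G$ is a finite group and $S$ a generating set with $e\notin S$. Three players take turns in the cyclic order Player 1, Player 2, Player 3, Player 1, and so on, starting from the empty word $w_0$. On turn $n$ the current player chooses $s_n\in S\cup S^{ -1}$, subject to $s_n\neq s_{n-1}^{ -1}$ when $n>1$, and forms $w_n=w_{n-1}s_n$. The first player to form a word $w_n$ representing the same element of $G$ as some earlier $w_k$ ($0\le k<n$) finishes first (wins). The player whose turn would come next finishes second (runner-up), and the remaining player finishes third. Each player plays to obtain the best possible finishing position: a player who cannot ensure a win plays so that the opponent whose win gives them second place is the one who wins. -}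

module Defs where

open import Data.Nat using (ℕ; zero; suc; _+_; _*_; _∸_)
open import Data.Nat.DivMod using (_mod_)
open import Data.Fin using (Fin; toℕ) renaming (zero to fzero; suc to fsuc)
import Data.Fin.Properties as FinP
open import Data.Bool using (Bool; true; false; _xor_; if_then_else_)
import Data.Bool.Properties as BoolP
open import Data.Product using (_×_; _,_)
open import Data.Product.Properties using (≡-dec)
open import Data.List using (List; []; _∷_; map; filter)
open import Data.List.Relation.Unary.Any using (any?)
open import Data.Maybe using (Maybe; just; nothing)
open import Relation.Nullary using (yes; no; ¬?)
open import Relation.Nullary.Decidable using (does)
open import Relation.Binary.Definitions using (DecidableEquality)

Player : Set
Player = Fin 3

player1 player2 player3 : Player
player1 = fzero
player2 = fsuc fzero
player3 = fsuc (fsuc fzero)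

nextP : Player → Player
nextP fzero = fsuc fzero
nextP (fsuc fzero) = fsuc (fsuc fzero)
nextP (fsuc (fsuc fzero)) = fzero

prevP : Player → Player
prevP fzero = fsuc (fsuc fzero)
prevP (fsuc fzero) = fzero
prevP (fsuc (fsuc fzero)) = fsuc fzero

-- Choice made by player p among the outcomes (= winners) reachable by
-- its legal moves: p wins if it can; otherwise p makes prevP p win
-- (then p, moving right after the winner, is runner-up); otherwise the
-- remaining player nextP p wins.
choose : Player → List Player → Player
choose p os with any? (λ o → o FinP.≟ p) os
... | yes _ = p
... | no _ with any? (λ o → o FinP.≟ prevP p) os
...   | yes _ = prevP p
...   | no _ = nextP p

-- The game REL_3(G,S) for a group given by a carrier with decidable
-- equality, multiplication, inverse, identity, and the list of letters
-- S ∪ S⁻¹ (as group elements, without repetition).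

module REL3 {A : Set} (_≟_ : DecidableEquality A)
            (_∙_ : A → A → A) (_⁻¹ : A → A) (e : A)
            (letters : List A) where

  legal : Maybe A → List A
  legal nothing = letters
  legal (just t) = filter (λ s → ¬? (s ≟ (t ⁻¹))) letters

  -- outcome fuel visited w last p :
  --   the winner under the players' preferences, when the words formed so
  --   far represent the elements in 'visited' (including the current one
  --   w), the last letter played is 'last' and p is to move.
  --   Each recursive call adds a new element to 'visited', so fuel
  --   ≥ |G| suffices; the 'zero' clause is never reached then.
  outcome : ℕ → List A → A → Maybe A → Player → Player
  outcome zero vis w last p = p
  outcome (suc k) vis w last p = choose p (map res (legal last))
    where
    res : A → Player
    res s with any? (λ v → (w ∙ s) ≟ v) vis
    ... | yes _ = p
    ... | no _ = outcome k ((w ∙ s) ∷ vis) (w ∙ s) (just s) (nextP p)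

  winner : ℕ → Player
  winner fuel = outcome fuel (e ∷ []) e nothing player1

-- The dihedral group D_n (n ≥ 1) of order 2n: the pair (k , b) stands
-- for r^k s^b, with k taken mod n.  Relations r^n = s^2 = rsrs = e, so
-- (r^a s^b)(r^c s^d) = r^(a + (-1)^b c) s^(b xor d).

Dih : ℕ → Set
Dih n = Fin n × Bool

negRot : ∀ {n} → Fin n → Fin n
negRot {suc m} a = (suc m ∸ toℕ a) mod (suc m)

addRot : ∀ {n} → Fin n → Fin n → Fin n
addRot {suc m} a b = (toℕ a + toℕ b) mod (suc m)

dihMul : ∀ {n} → Dih n → Dih n → Dih n
dihMul (a , b) (c , d) = addRot a (if b then negRot c else c) , (b xor d)

dihInv : ∀ {n} → Dih n → Dih n
dihInv (a , false) = negRot a , false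
dihInv (a , true) = a , true

dihE : ∀ {n} → Dih (suc n)
dihE = fzero , false

dihR : ∀ {n} → Dih (suc n)
dihR {m} = (1 mod (suc m)) , false

dihS : ∀ {n} → Dih (suc n)
dihS = fzero , true

dih≟ : ∀ {n} → DecidableEquality (Dih n)
dih≟ = ≡-dec FinP._≟_ BoolP._≟_

-- Winner of REL_3(D_n, {r, s}) under the stated preferences.
-- S ∪ S⁻¹ = {r, r⁻¹, s} (s⁻¹ = s; r ≠ r⁻¹ for n ≥ 3).
-- Fuel 2n = |D_n|.  (n = 0 is a junk value, excluded in the theorem.)
dihedralWinner : ℕ → Player
dihedralWinner zero = player1
dihedralWinner (suc m) =
  REL3.winner (dih≟ {suc m}) dihMul dihInv dihE
              (dihR ∷ dihInv dihR ∷ dihS ∷ []) (2 * suc m)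

module Submission where

-- The Cayley graph of D_n for {r, s} is a prism: two n-cycles, the cosets of ⟨r⟩, joined by
-- s-rungs.  A play is a walk without immediate backtracking, and the first revisit wins.  After
-- the opening move the walk runs around the prism in one rotational direction; at each column
-- the mover may go on, cross the rung, or (just after crossing) step back, and a step back, or
-- a rung one column after the previous one, hands the next player an immediate revisit.  Hence
-- every position is valued by an explicit recursion in the number R of columns left before the
-- walk closes up, whose values are periodic in R with period 4; computing the first period
-- shows that the winner depends only on the parity of n.

open import Defs
open import Data.Bool using (Bool; true; false; not; if_then_else_)
open import Data.Bool.Properties using (not-involutive; not-¬)
open import Data.Fin using (Fin; toℕ) renaming (zero to fzero; suc to fsuc)
open import Data.Fin.Properties using (toℕ-fromℕ<; toℕ-injective; toℕ<n) renaming (_≟_ to _≟ᶠ_)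
open import Data.List using (List; []; _∷_; filter)
open import Data.List.Properties using (filter-accept; filter-reject)
open import Data.List.Membership.Propositional using (_∈_; _∉_)
open import Data.List.Relation.Unary.Any using (any?; here; there)
import Data.List.Relation.Unary.Any as Any
open import Data.List.Relation.Binary.Permutation.Propositional
  using (_↭_; ↭-refl; ↭-sym; ↭-trans; ↭-swap)
open import Data.List.Relation.Binary.Permutation.Propositional.Properties using (Any-resp-↭; map⁺)
open import Data.Maybe using (just; nothing)
open import Data.Nat using (ℕ; zero; suc; _+_; _*_; _∸_; _%_; _≤_; _<_; z≤n; s≤s; NonZero)
open import Data.Nat.DivMod
  using (_mod_; %-distribˡ-+; %-distribˡ-*; m%n%n≡m%n; [m+n]%n≡m%n; [m+kn]%n≡m%n; n%n≡0;
         m*n%n≡0; m<n⇒m%n≡m; m≤n⇒m%n≡m)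
open import Data.Nat.Properties
  using (≤-refl; ≤-trans; ≤-reflexive; ≤-<-trans; <⇒≤; <⇒≢; >⇒≢; n<1+n; n≤1+n; m≤n+m; +-monoʳ-≤; 1+n≢0;
         +-comm; +-assoc; +-suc; *-comm; *-assoc; *-identityʳ; m∸n≤m; m∸[m∸n]≡n; m+[n∸m]≡n; +-∸-assoc)
open import Data.Nat.Tactic.RingSolver using (solve-∀)
open import Data.Product using (_×_; _,_; proj₁; proj₂)
open import Data.Sum using (_⊎_; inj₁; inj₂)
open import Function using (_∘_)
open import Relation.Binary.Definitions using (DecidableEquality)
open import Relation.Binary.PropositionalEquality
  using (_≡_; _≢_; refl; sym; trans; cong; cong₂; subst; module ≡-Reasoning)
open import Relation.Nullary using (¬?; yes; no; contradiction)

∉-∷ : ∀ {A : Set} {x y : A} {xs} → x ≢ y → x ∉ xs → x ∉ y ∷ xs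
∉-∷ x≢y x∉xs (here x≡y)    = x≢y x≡y
∉-∷ x≢y x∉xs (there x∈xs) = x∉xs x∈xs

not-≢ : ∀ b → not b ≢ b
not-≢ b = not-¬ refl ∘ sym

choose-self : ∀ {p os} → p ∈ os → choose p os ≡ p
choose-self {p} {os} p∈os with any? (λ o → o ≟ᶠ p) os
... | yes _ = refl
... | no p∉os = contradiction (Any.map sym p∈os) p∉os

choose-resp-↭ : ∀ p {os os′} → os ↭ os′ → choose p os ≡ choose p os′
choose-resp-↭ p {os} {os′} π with any? (λ o → o ≟ᶠ p) os | any? (λ o → o ≟ᶠ p) os′
... | yes _ | yes _ = refl
... | yes a | no ¬a = contradiction (Any-resp-↭ π a) ¬a
... | no ¬a | yes a = contradiction (Any-resp-↭ (↭-sym π) a) ¬a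
... | no _  | no _ with any? (λ o → o ≟ᶠ prevP p) os | any? (λ o → o ≟ᶠ prevP p) os′
...   | yes _ | yes _ = refl
...   | yes a | no ¬a = contradiction (Any-resp-↭ π a) ¬a
...   | no ¬a | yes a = contradiction (Any-resp-↭ (↭-sym π) a) ¬a
...   | no _  | no _ = refl

-- Opaque because unfolding choose on open arguments during conversion checking blows up.
opaque
  choose₂ : Player → Player → Player → Player
  choose₂ p a b = choose p (a ∷ b ∷ [])

opaque
  unfolding choose₂

  choose₂-choose : ∀ p a b → choose₂ p a b ≡ choose p (a ∷ b ∷ [])
  choose₂-choose p a b = refl

choose₂-selfʳ : ∀ p a → choose₂ p a p ≡ p
choose₂-selfʳ p a = trans (choose₂-choose p a p) (choose-self {os = a ∷ p ∷ []} (there (here refl)))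

module REL3-Properties {A : Set} (_≟_ : DecidableEquality A)
                       (_∙_ : A → A → A) (_⁻¹ : A → A) (e : A) (letters : List A) where

  open REL3 _≟_ _∙_ _⁻¹ e letters

  -- The local move function of outcome, which cannot be referred to by name; opaque so that
  -- its arguments are recovered by unification.
  opaque
    moveOutcome : ℕ → List A → A → Player → A → Player
    moveOutcome fuel vis w p s with any? (λ v → (w ∙ s) ≟ v) vis
    ... | yes _ = p
    ... | no _ = outcome fuel ((w ∙ s) ∷ vis) (w ∙ s) (just s) (nextP p)

    outcome-unfold₂ : ∀ {fuel vis w last p a b} → legal last ≡ a ∷ b ∷ [] →
      outcome (suc fuel) vis w last p ≡
      choose p (moveOutcome fuel vis w p a ∷ moveOutcome fuel vis w p b ∷ [])
    outcome-unfold₂ {vis = vis} {w} {a = a} {b} eq rewrite eq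
      with any? (λ v → (w ∙ a) ≟ v) vis | any? (λ v → (w ∙ b) ≟ v) vis
    ... | yes _ | yes _ = refl
    ... | yes _ | no _  = refl
    ... | no _  | yes _ = refl
    ... | no _  | no _  = refl

    outcome-unfold₃ : ∀ {fuel vis w p a b c} → letters ≡ a ∷ b ∷ c ∷ [] →
      outcome (suc fuel) vis w nothing p ≡
      choose p (moveOutcome fuel vis w p a ∷ moveOutcome fuel vis w p b ∷ moveOutcome fuel vis w p c ∷ [])
    outcome-unfold₃ {vis = vis} {w} {a = a} {b} {c} eq rewrite eq
      with any? (λ v → (w ∙ a) ≟ v) vis | any? (λ v → (w ∙ b) ≟ v) vis | any? (λ v → (w ∙ c) ≟ v) vis
    ... | yes _ | yes _ | yes _ = refl
    ... | yes _ | yes _ | no _  = refl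
    ... | yes _ | no _  | yes _ = refl
    ... | yes _ | no _  | no _  = refl
    ... | no _  | yes _ | yes _ = refl
    ... | no _  | yes _ | no _  = refl
    ... | no _  | no _  | yes _ = refl
    ... | no _  | no _  | no _  = refl

    moveOutcome-revisit : ∀ {fuel vis w p s y} → w ∙ s ≡ y → y ∈ vis → moveOutcome fuel vis w p s ≡ p
    moveOutcome-revisit {vis = vis} {w} {s = s} refl y∈vis with any? (λ v → (w ∙ s) ≟ v) vis
    ... | yes _ = refl
    ... | no y∉vis = contradiction y∈vis y∉vis

    moveOutcome-fresh : ∀ {fuel vis w p s y} → w ∙ s ≡ y → y ∉ vis →
      moveOutcome fuel vis w p s ≡ outcome fuel (y ∷ vis) y (just s) (nextP p)
    moveOutcome-fresh {vis = vis} {w} {s = s} refl y∉vis with any? (λ v → (w ∙ s) ≟ v) vis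
    ... | yes y∈vis = contradiction y∈vis y∉vis
    ... | no _ = refl

  outcome-win₂ : ∀ {fuel vis w last p a b y} → legal last ≡ a ∷ b ∷ [] → w ∙ b ≡ y → y ∈ vis →
    outcome (suc fuel) vis w last p ≡ p
  outcome-win₂ {fuel} {vis} {w} {last} {p} {a} {b} leg wb≡y y∈vis =
    trans (outcome-unfold₂ {fuel} {vis} {w} {last} {p} leg)
          (choose-self {os = moveOutcome fuel vis w p a ∷ moveOutcome fuel vis w p b ∷ []}
                       (there (here (sym (moveOutcome-revisit wb≡y y∈vis)))))


-- Values of the positions of the walk, with p to move, R columns before the walk closes up,
-- on side Y, and z telling whether the s-neighbour of the identity has been visited: straight
-- after an advance along a side, crossed just after a rung, turned after an advance that
-- followed a rung.  wrapValue is the value of the move that closes the cycle.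
wrapValue : Bool → Bool → Player → Player
wrapValue z     false p = p
wrapValue true  true  p = p
wrapValue false true  p = nextP p

mutual
  straight turned crossed : Bool → ℕ → Bool → Player → Player
  straight z zero    Y p = choose₂ p (wrapValue z Y p) (crossed z zero (not Y) (nextP p))
  straight z (suc R) Y p = choose₂ p (straight z R Y (nextP p)) (crossed z (suc R) (not Y) (nextP p))
  turned   z zero    Y p = choose₂ p (wrapValue z Y p) (nextP p)
  turned   z (suc R) Y p = choose₂ p (straight z R Y (nextP p)) (nextP p)
  crossed  z zero    Y p = choose₂ p (wrapValue z Y p) (nextP p)
  crossed  z (suc R) Y p = choose₂ p (turned z R Y (nextP p)) (nextP p)

PeriodicAt : ℕ → Set
PeriodicAt R = ∀ z Y p → straight z (4 + R) Y p ≡ straight z R Y p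
                       × turned z (4 + R) Y p ≡ turned z R Y p
                       × crossed z (4 + R) Y p ≡ crossed z R Y p

opaque
  unfolding choose₂

  periodicAt-1 : PeriodicAt 1
  periodicAt-1 false false fzero               = refl , refl , refl
  periodicAt-1 false false (fsuc fzero)        = refl , refl , refl
  periodicAt-1 false false (fsuc (fsuc fzero)) = refl , refl , refl
  periodicAt-1 false true  fzero               = refl , refl , refl
  periodicAt-1 false true  (fsuc fzero)        = refl , refl , refl
  periodicAt-1 false true  (fsuc (fsuc fzero)) = refl , refl , refl
  periodicAt-1 true  false fzero               = refl , refl , refl
  periodicAt-1 true  false (fsuc fzero)        = refl , refl , refl
  periodicAt-1 true  false (fsuc (fsuc fzero)) = refl , refl , refl
  periodicAt-1 true  true  fzero               = refl , refl , refl
  periodicAt-1 true  true  (fsuc fzero)        = refl , refl , refl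
  periodicAt-1 true  true  (fsuc (fsuc fzero)) = refl , refl , refl

periodicAt-suc : ∀ {R} → PeriodicAt R → PeriodicAt (suc R)
periodicAt-suc {R} period z Y p =
  cong₂ (choose₂ p) (straight-periodic Y (nextP p)) (crossed-periodic (not Y) (nextP p)) ,
  cong (λ a → choose₂ p a (nextP p)) (straight-periodic Y (nextP p)) ,
  crossed-periodic Y p
  where
  straight-periodic : ∀ Y p → straight z (4 + R) Y p ≡ straight z R Y p
  straight-periodic Y p = proj₁ (period z Y p)

  crossed-periodic : ∀ Y p → crossed z (5 + R) Y p ≡ crossed z (suc R) Y p
  crossed-periodic Y p = cong (λ a → choose₂ p a (nextP p)) (proj₁ (proj₂ (period z Y (nextP p))))

periodic : ∀ R → PeriodicAt (suc R)
periodic zero    = periodicAt-1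
periodic (suc R) = periodicAt-suc {suc R} (periodic R)

-- r and r⁻¹ start the walk in the two directions; s is answered by an advance in either.
openingValue : ℕ → Player
openingValue R = choose player1 (straight false R false player2 ∷ straight false R false player2 ∷
                                 choose₂ player2 (turned true R true player3) (turned true R true player3) ∷ [])

openingValue-periodic : ∀ R → openingValue (5 + R) ≡ openingValue (suc R)
openingValue-periodic R =
  cong₂ (λ a b → choose player1 (a ∷ a ∷ choose₂ player2 b b ∷ []))
        (proj₁ (periodic R false false player2)) (proj₁ (proj₂ (periodic R true true player3)))

ParityClaim : ℕ → Player → Set
ParityClaim n w = (n % 2 ≡ 1 → w ≡ player1) × (n % 2 ≡ 0 → w ≡ player3)

opaque
  unfolding choose₂

  openingValue-parity-base : ∀ R → R < 4 → ParityClaim (suc R) (openingValue (suc R))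
  openingValue-parity-base 0 _ = (λ _ → refl) , (λ ())
  openingValue-parity-base 1 _ = (λ ()) , (λ _ → refl)
  openingValue-parity-base 2 _ = (λ _ → refl) , (λ ())
  openingValue-parity-base 3 _ = (λ ()) , (λ _ → refl)
  openingValue-parity-base (suc (suc (suc (suc _)))) (s≤s (s≤s (s≤s (s≤s ()))))

openingValue-parity : ∀ R → ParityClaim (suc R) (openingValue (suc R))
openingValue-parity 0 = openingValue-parity-base 0 (s≤s z≤n)
openingValue-parity 1 = openingValue-parity-base 1 (s≤s (s≤s z≤n))
openingValue-parity 2 = openingValue-parity-base 2 (s≤s (s≤s (s≤s z≤n)))
openingValue-parity 3 = openingValue-parity-base 3 (s≤s (s≤s (s≤s (s≤s z≤n))))
openingValue-parity (suc (suc (suc (suc R)))) =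
  subst (ParityClaim (suc R)) (sym (openingValue-periodic R)) (openingValue-parity R)

toℕ-mod : ∀ x n .{{_ : NonZero n}} → toℕ (x mod n) ≡ x % n
toℕ-mod x n = toℕ-fromℕ< _

%≡%⇒mod≡mod : ∀ x y n .{{_ : NonZero n}} → x % n ≡ y % n → x mod n ≡ y mod n
%≡%⇒mod≡mod x y n eq = toℕ-injective (trans (toℕ-mod x n) (trans eq (sym (toℕ-mod y n))))

module _ {m : ℕ} where

  private
    N = suc m

  toℕ-addRot : ∀ (a b : Fin N) → toℕ (addRot a b) ≡ (toℕ a + toℕ b) % N
  toℕ-addRot a b = toℕ-mod (toℕ a + toℕ b) N

  toℕ-negRot : ∀ (a : Fin N) → toℕ (negRot a) ≡ (N ∸ toℕ a) % N
  toℕ-negRot a = toℕ-mod (N ∸ toℕ a) N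

  addRot-mod : ∀ x y → addRot (x mod N) (y mod N) ≡ (x + y) mod N
  addRot-mod x y = %≡%⇒mod≡mod (toℕ (x mod N) + toℕ (y mod N)) (x + y) N (begin
    (toℕ (x mod N) + toℕ (y mod N)) % N ≡⟨ cong₂ (λ a b → (a + b) % N) (toℕ-mod x N) (toℕ-mod y N) ⟩
    (x % N + y % N) % N                 ≡⟨ %-distribˡ-+ x y N ⟨
    (x + y) % N                         ∎)
    where open ≡-Reasoning

  addRot-negRot-cancelʳ : ∀ (a b : Fin N) → addRot (addRot a b) (negRot b) ≡ a
  addRot-negRot-cancelʳ a b = toℕ-injective (begin
    toℕ (addRot (addRot a b) (negRot b))           ≡⟨ toℕ-addRot (addRot a b) (negRot b) ⟩
    (toℕ (addRot a b) + toℕ (negRot b)) % N        ≡⟨ cong₂ (λ x y → (x + y) % N) (toℕ-addRot a b) (toℕ-negRot b) ⟩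
    ((toℕ a + toℕ b) % N + (N ∸ toℕ b) % N) % N    ≡⟨ %-distribˡ-+ (toℕ a + toℕ b) (N ∸ toℕ b) N ⟨
    (toℕ a + toℕ b + (N ∸ toℕ b)) % N              ≡⟨ cong (_% N) (+-assoc (toℕ a) (toℕ b) (N ∸ toℕ b)) ⟩
    (toℕ a + (toℕ b + (N ∸ toℕ b))) % N            ≡⟨ cong (λ x → (toℕ a + x) % N) (m+[n∸m]≡n (<⇒≤ (toℕ<n b))) ⟩
    (toℕ a + N) % N                                ≡⟨ [m+n]%n≡m%n (toℕ a) N ⟩
    toℕ a % N                                      ≡⟨ m<n⇒m%n≡m (toℕ<n a) ⟩
    toℕ a                                          ∎)
    where open ≡-Reasoning

  negRot-zero : negRot {N} fzero ≡ fzero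
  negRot-zero = toℕ-injective (trans (toℕ-negRot fzero) (n%n≡0 N))

  addRot-zero : ∀ (a : Fin N) → addRot a fzero ≡ a
  addRot-zero a = toℕ-injective (begin
    toℕ (addRot a fzero) ≡⟨ toℕ-addRot a fzero ⟩
    (toℕ a + 0) % N      ≡⟨ cong (_% N) (+-comm (toℕ a) 0) ⟩
    toℕ a % N            ≡⟨ m<n⇒m%n≡m (toℕ<n a) ⟩
    toℕ a                ∎)
    where open ≡-Reasoning

  negRot-involutive : ∀ (a : Fin N) → negRot (negRot a) ≡ a
  negRot-involutive fzero    = trans (cong negRot negRot-zero) negRot-zero
  negRot-involutive (fsuc i) = toℕ-injective (begin
    toℕ (negRot (negRot (fsuc i)))   ≡⟨ toℕ-negRot (negRot (fsuc i)) ⟩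
    (N ∸ toℕ (negRot (fsuc i))) % N  ≡⟨ cong (λ x → (N ∸ x) % N) toℕ-negRot-fsuc ⟩
    (N ∸ (m ∸ toℕ i)) % N            ≡⟨ cong (_% N) (+-∸-assoc 1 (m∸n≤m m (toℕ i))) ⟩
    suc (m ∸ (m ∸ toℕ i)) % N        ≡⟨ cong (λ x → suc x % N) (m∸[m∸n]≡n (<⇒≤ (toℕ<n i))) ⟩
    suc (toℕ i) % N                  ≡⟨ m<n⇒m%n≡m (s≤s (toℕ<n i)) ⟩
    suc (toℕ i)                      ∎)
    where
    open ≡-Reasoning
    toℕ-negRot-fsuc : toℕ (negRot (fsuc i)) ≡ m ∸ toℕ i
    toℕ-negRot-fsuc = trans (toℕ-negRot (fsuc i)) (m≤n⇒m%n≡m (m∸n≤m m (toℕ i)))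

  dihInv-involutive : ∀ (x : Dih N) → dihInv (dihInv x) ≡ x
  dihInv-involutive (a , false) = cong (_, false) (negRot-involutive a)
  dihInv-involutive (a , true)  = refl

  dihMul-s : ∀ (a : Fin N) b → dihMul (a , b) dihS ≡ (a , not b)
  dihMul-s a false = cong (_, true) (addRot-zero a)
  dihMul-s a true  = cong (_, false) (trans (cong (addRot a) negRot-zero) (addRot-zero a))

module Dihedral (k : ℕ) where

  n m : ℕ
  n = 3 + k
  m = 2 + k

  r r⁻¹ s : Dih n
  r   = dihR
  r⁻¹ = dihInv r
  s   = dihS

  open REL3 (dih≟ {n}) dihMul dihInv dihE (r ∷ r⁻¹ ∷ s ∷ [])
  open REL3-Properties (dih≟ {n}) dihMul dihInv dihE (r ∷ r⁻¹ ∷ s ∷ [])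

  r≢r⁻¹ : r ≢ r⁻¹
  r≢r⁻¹ r≡r⁻¹ with trans (cong (toℕ ∘ proj₁) r≡r⁻¹) (trans (toℕ-mod m n) (m<n⇒m%n≡m (n<1+n m)))
  ... | ()

  r⁻¹⁻¹≡r : dihInv r⁻¹ ≡ r
  r⁻¹⁻¹≡r = dihInv-involutive r

  legal-r : legal (just r) ≡ r ∷ s ∷ []
  legal-r = begin
    filter P? (r ∷ r⁻¹ ∷ s ∷ []) ≡⟨ filter-accept P? r≢r⁻¹ ⟩
    r ∷ filter P? (r⁻¹ ∷ s ∷ []) ≡⟨ cong (r ∷_) (filter-reject P? (λ r⁻¹≢r⁻¹ → r⁻¹≢r⁻¹ refl)) ⟩
    r ∷ filter P? (s ∷ [])       ≡⟨ cong (r ∷_) (filter-accept P? (λ ())) ⟩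
    r ∷ s ∷ []                   ∎
    where
    open ≡-Reasoning
    P? = λ x → ¬? (dih≟ x r⁻¹)

  legal-r⁻¹ : legal (just r⁻¹) ≡ r⁻¹ ∷ s ∷ []
  legal-r⁻¹ = begin
    filter P? (r ∷ r⁻¹ ∷ s ∷ []) ≡⟨ filter-reject P? (λ r≢ → r≢ (sym r⁻¹⁻¹≡r)) ⟩
    filter P? (r⁻¹ ∷ s ∷ [])     ≡⟨ filter-accept P? (λ eq → r≢r⁻¹ (sym (trans eq r⁻¹⁻¹≡r))) ⟩
    r⁻¹ ∷ filter P? (s ∷ [])     ≡⟨ cong (r⁻¹ ∷_) (filter-accept P? (λ eq → s≢r (trans eq r⁻¹⁻¹≡r))) ⟩
    r⁻¹ ∷ s ∷ []                 ∎
    where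
    open ≡-Reasoning
    P? = λ x → ¬? (dih≟ x (dihInv r⁻¹))
    s≢r : s ≢ r
    s≢r ()

  legal-s : legal (just s) ≡ r ∷ r⁻¹ ∷ []
  legal-s = begin
    filter P? (r ∷ r⁻¹ ∷ s ∷ []) ≡⟨ filter-accept P? {xs = r⁻¹ ∷ s ∷ []} (λ ()) ⟩
    r ∷ filter P? (r⁻¹ ∷ s ∷ []) ≡⟨ cong (r ∷_) (filter-accept P? {xs = s ∷ []} (λ ())) ⟩
    r ∷ r⁻¹ ∷ filter P? (s ∷ []) ≡⟨ cong (λ xs → r ∷ r⁻¹ ∷ xs) (filter-reject P? {xs = []} (λ s≢s → s≢s refl)) ⟩
    r ∷ r⁻¹ ∷ []                 ∎
    where
    open ≡-Reasoning
    P? = λ x → ¬? (dih≟ x s)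

  1<n : 1 < n
  1<n = s≤s (s≤s z≤n)

  RotationLetter : Dih n → Set
  RotationLetter x = x ≡ r ⊎ x ≡ r⁻¹

  legal-rotation : ∀ {x} → RotationLetter x → legal (just x) ≡ x ∷ s ∷ []
  legal-rotation (inj₁ refl) = legal-r
  legal-rotation (inj₂ refl) = legal-r⁻¹

  rotation-inv : ∀ {x} → RotationLetter x → RotationLetter (dihInv x)
  rotation-inv (inj₁ refl) = inj₂ refl
  rotation-inv (inj₂ refl) = inj₁ r⁻¹⁻¹≡r

  rotation-pair : ∀ {x} → RotationLetter x → r ∷ r⁻¹ ∷ [] ↭ x ∷ dihInv x ∷ []
  rotation-pair (inj₁ refl) = ↭-refl
  rotation-pair (inj₂ refl) =
    subst (λ y → r ∷ r⁻¹ ∷ [] ↭ r⁻¹ ∷ y ∷ []) (sym r⁻¹⁻¹≡r) (↭-swap r r⁻¹ ↭-refl)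

  -- The walk in the direction of r^d, with column j at r^(jd); the two directions are d = 1
  -- and d = n − 1, and d² ≡ 1 (mod n) makes the columns 0, …, n − 1 distinct.
  module Ladder (d : ℕ) (d²≡1 : d * d % n ≡ 1) (rotation : RotationLetter (d mod n , false)) where

    δ : Fin n
    δ = d mod n

    column : ℕ → Fin n
    column j = (j * d) mod n

    cell : ℕ → Bool → Dih n
    cell j b = (column j , b)

    -- On the side r^a s a rotation letter acts inversely, as r^a s r = r^(a − 1) s.
    forward backward : Bool → Dih n
    forward b  = if b then dihInv (δ , false) else (δ , false)
    backward b = forward (not b)

    column-suc : ∀ j → addRot (column j) δ ≡ column (suc j)
    column-suc j = trans (addRot-mod (j * d) d) (cong (_mod n) (+-comm (j * d) d))

    column-pred : ∀ j → addRot (column (suc j)) (negRot δ) ≡ column j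
    column-pred j = trans (cong (λ c → addRot c (negRot δ)) (sym (column-suc j)))
                          (addRot-negRot-cancelʳ (column j) δ)

    column-wraps : column n ≡ column 0
    column-wraps = %≡%⇒mod≡mod (n * d) 0 n (trans (cong (_% n) (*-comm n d)) (m*n%n≡0 d n))

    column-injective : ∀ {i j} → i < n → j < n → column i ≡ column j → i ≡ j
    column-injective {i} {j} i<n j<n eq = begin
      i                        ≡⟨ m<n⇒m%n≡m i<n ⟨
      i % n                    ≡⟨ unscale i ⟨
      (toℕ (column i) * d) % n ≡⟨ cong (λ c → (toℕ c * d) % n) eq ⟩
      (toℕ (column j) * d) % n ≡⟨ unscale j ⟩
      j % n                    ≡⟨ m<n⇒m%n≡m j<n ⟩
      j                        ∎
      where
      open ≡-Reasoning
      unscale : ∀ x → (toℕ (column x) * d) % n ≡ x % n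
      unscale x = begin
        (toℕ (column x) * d) % n   ≡⟨ cong (λ t → (t * d) % n) (toℕ-mod (x * d) n) ⟩
        (x * d % n * d) % n        ≡⟨ %-distribˡ-* (x * d % n) d n ⟩
        (x * d % n % n * (d % n)) % n ≡⟨ cong (λ t → (t * (d % n)) % n) (m%n%n≡m%n (x * d) n) ⟩
        (x * d % n * (d % n)) % n  ≡⟨ %-distribˡ-* (x * d) d n ⟨
        (x * d * d) % n            ≡⟨ cong (_% n) (*-assoc x d d) ⟩
        (x * (d * d)) % n          ≡⟨ %-distribˡ-* x (d * d) n ⟩
        (x % n * (d * d % n)) % n  ≡⟨ cong (λ t → (x % n * t) % n) d²≡1 ⟩
        (x % n * 1) % n            ≡⟨ cong (_% n) (*-identityʳ (x % n)) ⟩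
        x % n % n                  ≡⟨ m%n%n≡m%n x n ⟩
        x % n                      ∎

    forward-step : ∀ j b → dihMul (cell j b) (forward b) ≡ cell (suc j) b
    forward-step j false = cong (_, false) (column-suc j)
    forward-step j true  = cong (_, true) (trans (cong (addRot (column j)) (negRot-involutive δ)) (column-suc j))

    backward-step : ∀ j b → dihMul (cell (suc j) b) (backward b) ≡ cell j b
    backward-step j false = cong (_, false) (column-pred j)
    backward-step j true  = cong (_, true) (column-pred j)

    cross-step : ∀ j b → dihMul (cell j b) s ≡ cell j (not b)
    cross-step j = dihMul-s (column j)

    uncross-step : ∀ j b → dihMul (cell j (not b)) s ≡ cell j b
    uncross-step j b = trans (cross-step j (not b)) (cong (cell j) (not-involutive b))

    forward-rotation : ∀ b → RotationLetter (forward b)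
    forward-rotation false = rotation
    forward-rotation true  = rotation-inv rotation

    s-successors : ∀ b → r ∷ r⁻¹ ∷ [] ↭ forward b ∷ backward b ∷ []
    s-successors false = rotation-pair rotation
    s-successors true  = ↭-trans (rotation-pair rotation) (↭-swap _ _ ↭-refl)

    outcome-forward : ∀ {fuel vis w p} b → outcome (suc fuel) vis w (just (forward b)) p ≡
      choose₂ p (moveOutcome fuel vis w p (forward b)) (moveOutcome fuel vis w p s)
    outcome-forward {fuel} {vis} {w} {p} b =
      trans (outcome-unfold₂ {fuel} {vis} {w} {just (forward b)} {p} (legal-rotation (forward-rotation b)))
            (sym (choose₂-choose p _ _))

    outcome-after-s : ∀ {fuel vis w p} b → outcome (suc fuel) vis w (just s) p ≡
      choose₂ p (moveOutcome fuel vis w p (forward b)) (moveOutcome fuel vis w p (backward b))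
    outcome-after-s {fuel} {vis} {w} {p} b =
      trans (outcome-unfold₂ {fuel} {vis} {w} {just s} {p} legal-s)
            (trans (choose-resp-↭ p (map⁺ (moveOutcome fuel vis w p) (s-successors b)))
                   (sym (choose₂-choose p _ _)))

    cell-≢-column : ∀ {i j b b′} → i ≢ j → i < n → j < n → cell i b ≢ cell j b′
    cell-≢-column i≢j i<n j<n eq = i≢j (column-injective i<n j<n (cong proj₁ eq))

    side-≢ : ∀ {a a′ : Fin n} {b b′ : Bool} → b ≢ b′ → (a , b) ≢ (a′ , b′)
    side-≢ b≢b′ eq = b≢b′ (cong proj₂ eq)

    column-bound : ∀ R {c} → R + c ≡ m → c < n
    column-bound R {c} R+c≡m = s≤s (subst (c ≤_) R+c≡m (m≤n+m c R))

    record Explored (c : ℕ) (z : Bool) (vis : List (Dih n)) : Set where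
      field
        beyond-unvisited : ∀ {j} b → c < j → j < n → cell j b ∉ vis
        origin-visited   : cell 0 false ∈ vis
        opposite-origin  : if z then cell 0 true ∈ vis else cell 0 true ∉ vis

    open Explored

    Explored-extend : ∀ {c z vis} j b → c ≤ j → 0 < j → j < n →
      Explored c z vis → Explored j z (cell j b ∷ vis)
    Explored-extend {c} {z} {vis} j b c≤j 0<j j<n E = record
      { beyond-unvisited = λ b′ j<j′ j′<n →
          ∉-∷ (cell-≢-column (>⇒≢ j<j′) j′<n j<n) (beyond-unvisited E b′ (≤-<-trans c≤j j<j′) j′<n)
      ; origin-visited   = there (origin-visited E)
      ; opposite-origin  = extend z (opposite-origin E)
      }
      where
      extend : ∀ z → if z then cell 0 true ∈ vis else cell 0 true ∉ vis →
                     if z then cell 0 true ∈ cell j b ∷ vis else cell 0 true ∉ cell j b ∷ vis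
      extend true  0t∈vis = there 0t∈vis
      extend false 0t∉vis = ∉-∷ (cell-≢-column (<⇒≢ 0<j) (s≤s z≤n) j<n) 0t∉vis

    record StraightAt (c : ℕ) (Y : Bool) (vis : List (Dih n)) : Set where
      field
        current-visited         : cell (suc c) Y ∈ vis
        across-unvisited        : cell (suc c) (not Y) ∉ vis
        behind-visited          : cell c Y ∈ vis
        behind-across-unvisited : cell c (not Y) ∉ vis

    -- In TurnedAt and CrossedAt the walk stands on cell (suc c) (not X).
    record TurnedAt (c : ℕ) (X : Bool) (vis : List (Dih n)) : Set where
      field
        current-visited       : cell (suc c) (not X) ∈ vis
        across-unvisited      : cell (suc c) X ∉ vis
        behind-across-visited : cell c X ∈ vis

    record CrossedAt (c : ℕ) (X : Bool) (vis : List (Dih n)) : Set where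
      field
        across-visited        : cell (suc c) X ∈ vis
        behind-unvisited      : cell c (not X) ∉ vis
        behind-across-visited : cell c X ∈ vis

    forward-wraps : ∀ Y → dihMul (cell m Y) (forward Y) ≡ cell 0 Y
    forward-wraps Y = trans (forward-step m Y) (cong (_, Y) column-wraps)

    wrap-move : ∀ {z Y p fuel vis} → Explored m z vis →
      moveOutcome (suc fuel) vis (cell m Y) p (forward Y) ≡ wrapValue z Y p
    wrap-move {z}     {false} E = moveOutcome-revisit (forward-wraps false) (origin-visited E)
    wrap-move {true}  {true}  E = moveOutcome-revisit (forward-wraps true) (opposite-origin E)
    wrap-move {false} {true} {p} {fuel} {vis} E =
      trans (moveOutcome-fresh (forward-wraps true) (opposite-origin E))
            (outcome-win₂ {fuel} {cell 0 true ∷ vis} {cell 0 true} {just (forward true)} {nextP p}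
                          (legal-rotation (forward-rotation true)) (uncross-step 0 false) (there (origin-visited E)))

    advance : ∀ {c z Y p fuel vis} → suc (suc c) < n → Explored (suc c) z vis →
      moveOutcome fuel vis (cell (suc c) Y) p (forward Y) ≡
      outcome fuel (cell (2 + c) Y ∷ vis) (cell (2 + c) Y) (just (forward Y)) (nextP p)
    advance {c} {Y = Y} bound E = moveOutcome-fresh (forward-step (suc c) Y) (beyond-unvisited E Y ≤-refl bound)

    cross-from-turned : ∀ {c X p fuel vis} → TurnedAt c X vis →
      moveOutcome (suc fuel) vis (cell (suc c) (not X)) p s ≡ nextP p
    cross-from-turned {c} {X} {p} {fuel} {vis} T =
      trans (moveOutcome-fresh (uncross-step (suc c) X) (TurnedAt.across-unvisited T))
            (trans (outcome-after-s {fuel} {cell (suc c) X ∷ vis} {cell (suc c) X} {nextP p} X)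
                   (trans (cong (choose₂ (nextP p) _)
                                (moveOutcome-revisit (backward-step c X) (there (TurnedAt.behind-across-visited T))))
                          (choose₂-selfʳ (nextP p) _)))

    back-from-crossed : ∀ {c X p fuel vis} → CrossedAt c X vis →
      moveOutcome (suc fuel) vis (cell (suc c) (not X)) p (backward (not X)) ≡ nextP p
    back-from-crossed {c} {X} {p} {fuel} {vis} C =
      trans (moveOutcome-fresh (backward-step c (not X)) (CrossedAt.behind-unvisited C))
            (outcome-win₂ {fuel} {cell c (not X) ∷ vis} {cell c (not X)} {just (backward (not X))} {nextP p}
                          (legal-rotation (forward-rotation (not (not X)))) (uncross-step c X)
                          (there (CrossedAt.behind-across-visited C)))

    R+R≤R+1+R : ∀ R → R + R ≤ R + suc R
    R+R≤R+1+R R = +-monoʳ-≤ R (n≤1+n R)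

    -- From a position R columns before closing up, the play lasts at most 2R + 3 more moves.
    mutual
      straight-sim : ∀ R {c z Y p fuel vis} → R + suc c ≡ m → 2 + (R + R) ≤ fuel →
        Explored (suc c) z vis → StraightAt c Y vis →
        outcome (suc fuel) vis (cell (suc c) Y) (just (forward Y)) p ≡ straight z R Y p
      straight-sim zero {Y = Y} {p} {suc fuel} refl (s≤s enough) E S =
        trans (outcome-forward Y)
              (cong₂ (choose₂ p) (wrap-move E) (cross-from-straight zero refl enough E S))
      straight-sim (suc R) {c} {z} {Y} {p} {suc fuel} {vis} R+c≡m (s≤s enough) E S =
        trans (outcome-forward Y)
              (cong₂ (choose₂ p) advanced (cross-from-straight (suc R) R+c≡m enough E S))
        where
        R+c′≡m : R + suc (suc c) ≡ m
        R+c′≡m = trans (+-suc R (suc c)) R+c≡m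
        bound : 2 + c < n
        bound = column-bound R R+c′≡m
        S′ : StraightAt (suc c) Y (cell (2 + c) Y ∷ vis)
        S′ = record
          { current-visited         = here refl
          ; across-unvisited        = ∉-∷ (side-≢ (not-≢ Y)) (beyond-unvisited E (not Y) ≤-refl bound)
          ; behind-visited          = there (StraightAt.current-visited S)
          ; behind-across-unvisited = ∉-∷ (side-≢ (not-≢ Y)) (StraightAt.across-unvisited S)
          }
        advanced : moveOutcome (suc fuel) vis (cell (suc c) Y) p (forward Y) ≡ straight z R Y (nextP p)
        advanced = trans (advance bound E)
          (straight-sim R R+c′≡m (≤-trans (s≤s (s≤s (R+R≤R+1+R R))) enough)
                        (Explored-extend (2 + c) Y (n≤1+n _) (s≤s z≤n) bound E) S′)

      cross-from-straight : ∀ R {c z Y p fuel vis} → R + suc c ≡ m → 1 + (R + R) ≤ fuel →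
        Explored (suc c) z vis → StraightAt c Y vis →
        moveOutcome (suc fuel) vis (cell (suc c) Y) p s ≡ crossed z R (not Y) (nextP p)
      cross-from-straight R {c} {Y = Y} {vis = vis} R+c≡m enough E S =
        trans (moveOutcome-fresh (cross-step (suc c) Y) (StraightAt.across-unvisited S))
              (crossed-sim R R+c≡m enough (Explored-extend (suc c) (not Y) ≤-refl (s≤s z≤n) bound E) C′)
        where
        bound : suc c < n
        bound = column-bound R R+c≡m
        C′ : CrossedAt c Y (cell (suc c) (not Y) ∷ vis)
        C′ = record
          { across-visited        = there (StraightAt.current-visited S)
          ; behind-unvisited      = ∉-∷ (cell-≢-column (<⇒≢ (n<1+n c)) (≤-trans (n≤1+n _) bound) bound)
                                        (StraightAt.behind-across-unvisited S)
          ; behind-across-visited = there (StraightAt.behind-visited S)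
          }

      turned-sim : ∀ R {c z X p fuel vis} → R + suc c ≡ m → 1 + (R + R) ≤ fuel →
        Explored (suc c) z vis → TurnedAt c X vis →
        outcome (suc fuel) vis (cell (suc c) (not X)) (just (forward (not X))) p ≡ turned z R (not X) p
      turned-sim zero {X = X} {p} {suc fuel} refl (s≤s _) E T =
        trans (outcome-forward (not X)) (cong₂ (choose₂ p) (wrap-move E) (cross-from-turned T))
      turned-sim (suc R) {c} {z} {X} {p} {suc fuel} {vis} R+c≡m (s≤s enough) E T =
        trans (outcome-forward (not X)) (cong₂ (choose₂ p) advanced (cross-from-turned T))
        where
        R+c′≡m : R + suc (suc c) ≡ m
        R+c′≡m = trans (+-suc R (suc c)) R+c≡m
        bound : 2 + c < n
        bound = column-bound R R+c′≡m
        S′ : StraightAt (suc c) (not X) (cell (2 + c) (not X) ∷ vis)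
        S′ = record
          { current-visited         = here refl
          ; across-unvisited        = ∉-∷ (side-≢ (not-≢ (not X))) (beyond-unvisited E (not (not X)) ≤-refl bound)
          ; behind-visited          = there (TurnedAt.current-visited T)
          ; behind-across-unvisited = ∉-∷ (side-≢ (not-≢ (not X)))
              (subst (_∉ vis) (cong (cell (suc c)) (sym (not-involutive X))) (TurnedAt.across-unvisited T))
          }
        advanced : moveOutcome (suc fuel) vis (cell (suc c) (not X)) p (forward (not X)) ≡
                   straight z R (not X) (nextP p)
        advanced = trans (advance bound E)
          (straight-sim R R+c′≡m (subst (λ t → suc t ≤ fuel) (+-suc R R) enough)
                        (Explored-extend (2 + c) (not X) (n≤1+n _) (s≤s z≤n) bound E) S′)

      crossed-sim : ∀ R {c z X p fuel vis} → R + suc c ≡ m → 1 + (R + R) ≤ fuel →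
        Explored (suc c) z vis → CrossedAt c X vis →
        outcome (suc fuel) vis (cell (suc c) (not X)) (just s) p ≡ crossed z R (not X) p
      crossed-sim zero {X = X} {p} {suc fuel} refl (s≤s _) E C =
        trans (outcome-after-s (not X)) (cong₂ (choose₂ p) (wrap-move E) (back-from-crossed C))
      crossed-sim (suc R) {c} {z} {X} {p} {suc fuel} {vis} R+c≡m (s≤s enough) E C =
        trans (outcome-after-s (not X)) (cong₂ (choose₂ p) advanced (back-from-crossed C))
        where
        R+c′≡m : R + suc (suc c) ≡ m
        R+c′≡m = trans (+-suc R (suc c)) R+c≡m
        bound : 2 + c < n
        bound = column-bound R R+c′≡m
        T′ : TurnedAt (suc c) X (cell (2 + c) (not X) ∷ vis)
        T′ = record
          { current-visited       = here refl
          ; across-unvisited      = ∉-∷ (side-≢ (not-≢ X ∘ sym)) (beyond-unvisited E X ≤-refl bound)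
          ; behind-across-visited = there (CrossedAt.across-visited C)
          }
        advanced : moveOutcome (suc fuel) vis (cell (suc c) (not X)) p (forward (not X)) ≡
                   turned z R (not X) (nextP p)
        advanced = trans (advance bound E)
          (turned-sim R R+c′≡m (≤-trans (s≤s (R+R≤R+1+R R)) enough)
                      (Explored-extend (2 + c) (not X) (n≤1+n _) (s≤s z≤n) bound E) T′)

    explored-origin : Explored 0 false (cell 0 false ∷ [])
    explored-origin = record
      { beyond-unvisited = λ b 0<j j<n → ∉-∷ (cell-≢-column (>⇒≢ 0<j) j<n (s≤s z≤n)) (λ ())
      ; origin-visited   = here refl
      ; opposite-origin  = ∉-∷ (side-≢ (λ ())) (λ ())
      }

    explored-origin-sides : Explored 0 true (cell 0 true ∷ cell 0 false ∷ [])
    explored-origin-sides = record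
      { beyond-unvisited = λ b 0<j j<n →
          ∉-∷ (cell-≢-column (>⇒≢ 0<j) j<n (s≤s z≤n)) (∉-∷ (cell-≢-column (>⇒≢ 0<j) j<n (s≤s z≤n)) (λ ()))
      ; origin-visited   = there (here refl)
      ; opposite-origin  = here refl
      }

    opening-advance : ∀ {fuel} → 2 + (suc k + suc k) ≤ fuel →
      moveOutcome (suc fuel) (dihE ∷ []) dihE player1 (forward false) ≡ straight false (suc k) false player2
    opening-advance enough =
      trans (moveOutcome-fresh (forward-step 0 false) (∉-∷ (cell-≢-column (1+n≢0 {0}) 1<n (s≤s z≤n)) (λ ())))
            (straight-sim (suc k) (+-comm (suc k) 1) enough
                          (Explored-extend 1 false z≤n (s≤s z≤n) 1<n explored-origin) S)
      where
      S : StraightAt 0 false (cell 1 false ∷ cell 0 false ∷ [])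
      S = record
        { current-visited         = here refl
        ; across-unvisited        = ∉-∷ (side-≢ (λ ())) (∉-∷ (side-≢ (λ ())) (λ ()))
        ; behind-visited          = there (here refl)
        ; behind-across-unvisited = ∉-∷ (side-≢ (λ ())) (∉-∷ (side-≢ (λ ())) (λ ()))
        }

    opening-cross-advance : ∀ {fuel} → 1 + (suc k + suc k) ≤ fuel →
      moveOutcome (suc fuel) (cell 0 true ∷ dihE ∷ []) (cell 0 true) player2 (forward true) ≡
      turned true (suc k) true player3
    opening-cross-advance enough =
      trans (moveOutcome-fresh (forward-step 0 true)
                               (∉-∷ (cell-≢-column (1+n≢0 {0}) 1<n (s≤s z≤n)) (∉-∷ (side-≢ (λ ())) (λ ()))))
            (turned-sim (suc k) (+-comm (suc k) 1) enough
                        (Explored-extend 1 true z≤n (s≤s z≤n) 1<n explored-origin-sides) T)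
      where
      T : TurnedAt 0 false (cell 1 true ∷ cell 0 true ∷ cell 0 false ∷ [])
      T = record
        { current-visited       = here refl
        ; across-unvisited      = ∉-∷ (side-≢ (λ ())) (∉-∷ (cell-≢-column (1+n≢0 {0}) 1<n (s≤s z≤n))
                                    (∉-∷ (cell-≢-column (1+n≢0 {0}) 1<n (s≤s z≤n)) (λ ())))
        ; behind-across-visited = there (there (here refl))
        }

  m²≡1 : m * m % n ≡ 1
  m²≡1 = trans (cong (_% n) (square k)) ([m+kn]%n≡m%n 1 (1 + k) n)
    where
    square : ∀ k → (2 + k) * (2 + k) ≡ 1 + (1 + k) * (3 + k)
    square = solve-∀

  module Ascending  = Ladder 1 refl (inj₁ refl)
  module Descending = Ladder m m²≡1 (inj₂ refl)

  dihedralWinner≡openingValue : dihedralWinner n ≡ openingValue (suc k)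
  dihedralWinner≡openingValue =
    trans (outcome-unfold₃ {suc (suc fuel)} {dihE ∷ []} {dihE} {player1} refl)
          (cong₃ (Ascending.opening-advance (s≤s enough)) (Descending.opening-advance (s≤s enough)) after-s)
    where
    fuel : ℕ
    fuel = k + (n + 0)

    enough : 1 + (suc k + suc k) ≤ fuel
    enough = ≤-reflexive (fuel-identity k)
      where
      fuel-identity : ∀ k → 1 + (suc k + suc k) ≡ k + (3 + k + 0)
      fuel-identity = solve-∀

    cong₃ : ∀ {a a′ b b′ c c′} → a ≡ a′ → b ≡ b′ → c ≡ c′ →
      choose player1 (a ∷ b ∷ c ∷ []) ≡ choose player1 (a′ ∷ b′ ∷ c′ ∷ [])
    cong₃ refl refl refl = refl

    after-s : moveOutcome (suc (suc fuel)) (dihE ∷ []) dihE player1 s ≡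
              choose₂ player2 (turned true (suc k) true player3) (turned true (suc k) true player3)
    after-s =
      trans (moveOutcome-fresh (dihMul-s fzero false) (∉-∷ (λ ()) (λ ())))
            (trans (outcome-unfold₂ {suc fuel} {s ∷ dihE ∷ []} {s} {just s} {player2} legal-s)
                   (trans (cong₂ (λ a b → choose player2 (a ∷ b ∷ []))
                                 (trans (cong (moveOutcome (suc fuel) (s ∷ dihE ∷ []) s player2) (sym r⁻¹⁻¹≡r))
                                        (Descending.opening-cross-advance enough))
                                 (Ascending.opening-cross-advance enough))
                          (sym (choose₂-choose player2 _ _))))

theorem6p2 : (n : ℕ) → 3 ≤ n →
    (n % 2 ≡ 1 → dihedralWinner n ≡ player1) ×
    (n % 2 ≡ 0 → dihedralWinner n ≡ player3)
theorem6p2 (suc (suc (suc k))) (s≤s (s≤s (s≤s _))) =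
  subst (ParityClaim (suc k)) (sym (Dihedral.dihedralWinner≡openingValue k)) (openingValue-parity k)
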